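{- Let $\mathcal{X}=(\Omega,S)$ be a coherent configuration. Then $\mathcal{X}$ is quasitrivial if and only if for any two fibers $\Delta,\Lambda$ of $\mathcal{X}$, the set $S_{\Delta,\Lambda}$ either is a singleton or contains exactly two elements, one of which is (the graph of) a bijection $f:\Delta\to\Lambda$, i.e. the relation $\{(\delta,f(\delta)):\delta\in\Delta\}$.
   Context: Let $\Omega$ be a finite set. For $r\subseteq\Omega\times\Omega$ and $\alpha\in\Omega$ put $\alpha r=\{\beta:(\alpha,\beta)\in r\}$ and $r^*=\{(\beta,\alpha):(\alpha,\beta)\in r\}$. A coherent configuration on $\Omega$ is a pair $\mathcal{X}=(\Omega,S)$, where $S$ is a partition of $\Omega\times\Omega$ such that the diagonal $1_\Omega$ is a union of elements of $S$, $s^*\in S$ for all $s\in S$, and for all $r,s,t\in S$ the number $|\alpha r\cap\beta s^*|$ does not depend on the choice of $(\alpha,\beta)\in t$. The elements of $S$ are the basis relations. A fiber of $\mathcal{X}$ is a set $\Delta\subseteq\Omega$ with $1_\Delta=\{(\delta,\delta):\delta\in\Delta\}\in S$; $\Omega$ is the disjoint union of the fibers. For fibers $\Delta,\Lambda$, $S_{\Delta,\Lambda}=\{s\in S: s\subseteq \Delta\times\Lambda\}$. The automorphism group $\mathrm{Aut}(\mathcal{X})$ is the group of all permutations $f$ of $\Omega$ with $s^f=s$ for all $s\in S$; it leaves every fiber invariant, and for a fiber $\Delta$, $\mathrm{Aut}(\mathcal{X})^\Delta$ denotes the permutation group induced by $\mathrm{Aut}(\mathcal{X})$ on $\Delta$.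 The coherent configuration $\mathcal{X}$ is called quasitrivial if $\mathrm{Aut}(\mathcal{X})^\Delta=\mathrm{Sym}(\Delta)$ for every fiber $\Delta$. -}

module Defs where

open import Data.Nat using (ℕ)
open import Data.Fin using (Fin)
open import Data.Fin.Properties using (_≟_)
open import Data.List using (length; filter)
open import Data.Product using (Σ; ∃; _×_; _,_; proj₁; proj₂)
open import Data.Sum using (_⊎_)
open import Relation.Binary.PropositionalEquality using (_≡_)
open import Relation.Nullary using (¬_)
open import Relation.Nullary.Decidable using (_×-dec_)
open import Function.Bundles using (_↔_; _⇔_; Inverse)
import Data.List as L

-- Ω is Fin n.  The partition S of Ω×Ω into basis relations is encoded by a
-- surjective colouring  c : Ω → Ω → Fin m ; basis relation i is the
-- (nonempty) colour class  { (α,β) : c α β ≡ i }.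

Colouring : ℕ → ℕ → Set
Colouring n m = Fin n → Fin n → Fin m

-- |α r ∩ β s*| = #{ γ : (α,γ) ∈ r and (γ,β) ∈ s }
interCount : ∀ {n m} → Colouring n m → Fin m → Fin m → Fin n → Fin n → ℕ
interCount {n} c r s α β =
  length (filter (λ γ → (c α γ ≟ r) ×-dec (c γ β ≟ s)) (L.allFin n))

record CoherentConfiguration (n : ℕ) : Set where
  field
    m : ℕ
    c : Colouring n m
    nonempty : ∀ (i : Fin m) → ∃ λ (p : Fin n × Fin n) → c (proj₁ p) (proj₂ p) ≡ i
    -- the diagonal 1_Ω is a union of basis relations
    diagonal : ∀ (α β γ : Fin n) → c β γ ≡ c α α → β ≡ γ
    converse : ∀ (s : Fin m) → ∃ λ (s' : Fin m) →
                 ∀ (α β : Fin n) → (c α β ≡ s) ⇔ (c β α ≡ s')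
    coherence : ∀ (r s : Fin m) (α β α' β' : Fin n) → c α β ≡ c α' β' →
                interCount c r s α β ≡ interCount c r s α' β'

module _ {n : ℕ} (X : CoherentConfiguration n) where
  open CoherentConfiguration X

  -- the fiber containing the point α₀ : { β : 1_β lies in the same basis relation as 1_α₀ }
  -- (every fiber is of this form, since 1_Ω is a union of basis relations)
  InFiber : Fin n → Fin n → Set
  InFiber α₀ β = c β β ≡ c α₀ α₀

  Fiber : Fin n → Set
  Fiber α₀ = Σ (Fin n) (InFiber α₀)

  IsAutomorphism : (Fin n ↔ Fin n) → Set
  IsAutomorphism f = ∀ (α β : Fin n) → c (Inverse.to f α) (Inverse.to f β) ≡ c α β

  InducesSym : Fin n → Set
  InducesSym α₀ = ∀ (g : Fiber α₀ ↔ Fiber α₀) → ∃ λ (f : Fin n ↔ Fin n) →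
    IsAutomorphism f ×
    (∀ (x : Fiber α₀) → Inverse.to f (proj₁ x) ≡ proj₁ (Inverse.to g x))

  Quasitrivial : Set
  Quasitrivial = ∀ (α₀ : Fin n) → InducesSym α₀

  -- s ∈ S_{Δ,Λ}  (Δ the fiber of δ₀, Λ the fiber of λ₀)
  InS : Fin n → Fin n → Fin m → Set
  InS δ₀ λ₀ s = ∀ (α β : Fin n) → c α β ≡ s → InFiber δ₀ α × InFiber λ₀ β

  IsBijectionGraph : Fin n → Fin n → Fin m → Set
  IsBijectionGraph δ₀ λ₀ s = ∃ λ (f : Fiber δ₀ ↔ Fiber λ₀) →
    ∀ (x : Fiber δ₀) (y : Fiber λ₀) →
      (c (proj₁ x) (proj₁ y) ≡ s) ⇔ (Inverse.to f x ≡ y)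

  IsSingleton : Fin n → Fin n → Set
  IsSingleton δ₀ λ₀ = ∃ λ (s : Fin m) → InS δ₀ λ₀ s ×
    (∀ (t : Fin m) → InS δ₀ λ₀ t → t ≡ s)

  TwoWithBijection : Fin n → Fin n → Set
  TwoWithBijection δ₀ λ₀ = ∃ λ (s : Fin m) → ∃ λ (s' : Fin m) →
    ¬ (s ≡ s') × InS δ₀ λ₀ s × InS δ₀ λ₀ s' ×
    (∀ (t : Fin m) → InS δ₀ λ₀ t → (t ≡ s) ⊎ (t ≡ s')) ×
    IsBijectionGraph δ₀ λ₀ s

  FiberCondition : Set
  FiberCondition = ∀ (δ₀ λ₀ : Fin n) → IsSingleton δ₀ λ₀ ⊎ TwoWithBijection δ₀ λ₀

-- ⇒: every transposition inside a fiber then lifts to an automorphism.  Transposing two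
-- points of Λ turns the row of δ ∈ Δ into another row; transposing two rows while fixing a
-- third maps the points where one row gains a colour over the third onto those where the
-- other row does.  Playing these off against each other, no row of Δ × Λ splits two
-- points against two and no row has three colours.  So either Δ × Λ is one relation, or
-- each row shows a colour s at exactly one point and a colour t elsewhere, and the points
-- coloured s form the graph of a bijection.
-- ⇐: a permutation g of Δ extends to Ω by sending β to the point F β with
-- c (g u) (F β) = c u β for all u ∈ Δ: the identity on fibers Λ with S_{Δ,Λ} a singleton,
-- and φ ∘ g ∘ φ⁻¹ along the bijection φ otherwise.  Coherence lets paths of colours
-- through Δ be transported, which shows that F preserves every colour; F for g⁻¹ inverts it.
module Submission where

open import Defs
open import Data.Nat using (ℕ)
open import Data.Fin using (Fin)
open import Data.Fin.Properties using (_≟_; any?)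
open import Data.Fin.Permutation.Components using (transpose; transpose-inverse)
open import Data.List using (List; _∷_; length; allFin)
open import Data.List.Membership.Propositional using (_∈_)
open import Data.List.Membership.Propositional.Properties using (∈-filter⁺; ∈-filter⁻; ∈-allFin)
open import Data.List.Relation.Unary.Any using (here)
open import Data.Product using (∃; ∃₂; _×_; _,_; proj₁; proj₂)
open import Data.Sum using (_⊎_; inj₁; inj₂)
import Data.Sum as Sum
open import Data.Empty using (⊥; ⊥-elim)
open import Function using (flip)
open import Function.Bundles using (_↔_; _⇔_; Inverse; mk↔ₛ′; mk⇔)
import Function.Bundles
open import Function.Properties.Inverse using (↔-sym)
open import Relation.Binary.PropositionalEquality
open import Relation.Nullary using (yes; no)
open import Relation.Nullary.Decidable using (_×-dec_; ¬?; dec-true; dec-false; decidable-stable)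
open import Axiom.UniquenessOfIdentityProofs using (module Decidable⇒UIP)

open Inverse using (to; from; strictlyInverseˡ; strictlyInverseʳ)
module ⇔ = Function.Bundles.Equivalence

transpose-matchˡ : ∀ {n} (i j : Fin n) → transpose i j i ≡ j
transpose-matchˡ i j rewrite dec-true (i ≟ i) refl = refl

transpose-matchʳ : ∀ {n} (i j : Fin n) → transpose i j j ≡ i
transpose-matchʳ i j with j ≟ i
... | yes j≡i = j≡i
... | no _ rewrite dec-true (j ≟ j) refl = refl

transpose-other : ∀ {n} {i j k : Fin n} → k ≢ i → k ≢ j → transpose i j k ≡ k
transpose-other {i = i} {j} {k} k≢i k≢j
  rewrite dec-false (k ≟ i) k≢i | dec-false (k ≟ j) k≢j = refl

transpose-closed : ∀ {n} {P : Fin n → Set} {i j} → P i → P j → ∀ {k} → P k → P (transpose i j k)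
transpose-closed {i = i} {j} pi pj {k} pk with k ≟ i
... | yes _ = pj
... | no _ with k ≟ j
...   | yes _ = pi
...   | no _ = pk

from-injective : ∀ {A B : Set} (f : A ↔ B) {x y} → from f x ≡ from f y → x ≡ y
from-injective f {x} {y} eq =
  trans (sym (strictlyInverseˡ f x)) (trans (cong (to f) eq) (strictlyInverseˡ f y))

nonempty-of-length-≡ : ∀ {A : Set} {x : A} (xs ys : List A) →
  length xs ≡ length ys → x ∈ xs → ∃ (_∈ ys)
nonempty-of-length-≡ (_ ∷ _) (y ∷ _) _ _ = y , here refl

≡-of-≢-in-pair : ∀ {A : Set} {s s′ d a b : A} → d ≡ s ⊎ d ≡ s′ → a ≡ s ⊎ a ≡ s′ →
  b ≡ s ⊎ b ≡ s′ → a ≢ d → b ≢ d → a ≡ b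
≡-of-≢-in-pair _        (inj₁ a≡s)  (inj₁ b≡s)  _ _ = trans a≡s (sym b≡s)
≡-of-≢-in-pair _        (inj₂ a≡s′) (inj₂ b≡s′) _ _ = trans a≡s′ (sym b≡s′)
≡-of-≢-in-pair (inj₁ d) (inj₁ a)    (inj₂ _)    a≢d _ = ⊥-elim (a≢d (trans a (sym d)))
≡-of-≢-in-pair (inj₂ d) (inj₁ _)    (inj₂ b)    _ b≢d = ⊥-elim (b≢d (trans b (sym d)))
≡-of-≢-in-pair (inj₁ d) (inj₂ _)    (inj₁ b)    _ b≢d = ⊥-elim (b≢d (trans b (sym d)))
≡-of-≢-in-pair (inj₂ d) (inj₂ a)    (inj₁ _)    a≢d _ = ⊥-elim (a≢d (trans a (sym d)))

module _ {n m : ℕ} (c : Colouring n m) where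

  InFiberOf : Fin n → Fin n → Set
  InFiberOf ρ w = c w w ≡ c ρ ρ

  record AutExtending (ρ : Fin n) (π : Fin n → Fin n) : Set where
    field
      aut       : Fin n ↔ Fin n
      preserves : ∀ α β → c (to aut α) (to aut β) ≡ c α β
      agrees    : ∀ w → InFiberOf ρ w → to aut w ≡ π w

    maps-fiber : ∀ {σ w} → InFiberOf σ w → InFiberOf σ (to aut w)
    maps-fiber = trans (preserves _ _)

    inverse-maps-fiber : ∀ {σ w} → InFiberOf σ w → InFiberOf σ (from aut w)
    inverse-maps-fiber {w = w} =
      trans (trans (sym (preserves _ _)) (cong₂ c (strictlyInverseˡ aut w) (strictlyInverseˡ aut w)))

    transports : ∀ {α α′} w → to aut α ≡ α′ → c α′ (to aut w) ≡ c α w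
    transports w refl = preserves _ w

    transports⁻ : ∀ {α α′} w → to aut α ≡ α′ → c α′ w ≡ c α (from aut w)
    transports⁻ w eq =
      trans (cong (c _) (sym (strictlyInverseˡ aut w))) (transports (from aut w) eq)

  TranspositionsLift : Set
  TranspositionsLift =
    ∀ ρ a b → InFiberOf ρ a → InFiberOf ρ b → AutExtending ρ (transpose a b)

module _ {n m} {c : Colouring n m} {ρ a b} (e : AutExtending c ρ (transpose a b)) where
  open AutExtending e

  transposition-swaps : InFiberOf c ρ a → to aut a ≡ b
  transposition-swaps pa = trans (agrees a pa) (transpose-matchˡ a b)

  transposition-fixes : ∀ {k} → InFiberOf c ρ k → k ≢ a → k ≢ b → to aut k ≡ k
  transposition-fixes pk k≢a k≢b = trans (agrees _ pk) (transpose-other k≢a k≢b)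

flip-lift : ∀ {n m} {c : Colouring n m} → TranspositionsLift c → TranspositionsLift (flip c)
flip-lift lift ρ a b pa pb = record
  { aut = aut ; preserves = λ α β → preserves β α ; agrees = agrees }
  where open AutExtending (lift ρ a b pa pb)

module RowGeometry {n m} (c : Colouring n m) (lift : TranspositionsLift c) where

  Gain : Fin n → Fin n → Fin n → Fin m → Fin n → Set
  Gain σ x x′ s w = InFiberOf c σ w × c x′ w ≡ s × c x w ≢ s

  transposed-row : ∀ {ρ σ x a b} → InFiberOf c ρ x → InFiberOf c σ a → InFiberOf c σ b →
    ∃ λ x′ → InFiberOf c ρ x′ × (∀ w → InFiberOf c σ w → c x′ w ≡ c x (transpose a b w))
  transposed-row {σ = σ} {x} {a} {b} px pa pb =
    from aut x , inverse-maps-fiber px ,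
    λ w pw → trans (sym (transports w (strictlyInverseˡ aut x))) (cong (c x) (agrees w pw))
    where open AutExtending (lift σ a b pa pb)

  transposed-gain : ∀ {σ x x′ a b s} →
    (∀ w → InFiberOf c σ w → c x′ w ≡ c x (transpose a b w)) → c x a ≡ s →
    ∀ {w} → Gain σ x x′ s w → w ≡ b
  transposed-gain {x = x} {a = a} {b} row xa {w} (pw , x′w , xw) with w ≟ b | w ≟ a
  ... | yes w≡b | _        = w≡b
  ... | no _    | yes refl = ⊥-elim (xw xa)
  ... | no w≢b  | no w≢a   =
    ⊥-elim (xw (trans (cong (c x) (sym (transpose-other w≢a w≢b))) (trans (sym (row w pw)) x′w)))

  -- The automorphism swapping x₁ and x₃ fixes x, so it maps the gain of x₁ over x
  -- bijectively onto the gain of x₃ over x.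
  gain-subsingleton : ∀ {ρ σ x x₁ x₃ s z} → InFiberOf c ρ x → InFiberOf c ρ x₁ →
    InFiberOf c ρ x₃ → x ≢ x₁ → x ≢ x₃ → (∀ {w} → Gain σ x x₁ s w → w ≡ z) →
    ∀ {w₁ w₂} → Gain σ x x₃ s w₁ → Gain σ x x₃ s w₂ → w₁ ≡ w₂
  gain-subsingleton {ρ} {σ} {x} {x₁} {x₃} {s} {z} px px₁ px₃ x≢x₁ x≢x₃ gain₁ g g′ =
    from-injective aut (trans (pulled-back g) (sym (pulled-back g′)))
    where
      e : AutExtending c ρ (transpose x₁ x₃)
      e = lift ρ x₁ x₃ px₁ px₃
      open AutExtending e
      fixes-x : to aut x ≡ x
      fixes-x = transposition-fixes e px x≢x₁ x≢x₃
      moves-x₁ : to aut x₁ ≡ x₃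
      moves-x₁ = transposition-swaps e px₁
      pulled-back : ∀ {w} → Gain σ x x₃ s w → from aut w ≡ z
      pulled-back {w} (pw , x₃w , xw) = gain₁
        ( inverse-maps-fiber pw
        , trans (sym (transports⁻ w moves-x₁)) x₃w
        , λ e → xw (trans (transports⁻ w fixes-x) e))

  -- Transposing y₁ with z gives a row x₁ gaining only z over x; transposing y₂ with z′ in
  -- x₁ gives a row x₃ gaining both z and z′.
  no-two-two-split : ∀ {ρ σ x y₁ y₂ z z′ s} → InFiberOf c ρ x →
    InFiberOf c σ y₁ → InFiberOf c σ y₂ → InFiberOf c σ z → InFiberOf c σ z′ →
    y₁ ≢ y₂ → z ≢ z′ → c x y₁ ≡ s → c x y₂ ≡ s → c x z ≢ s → c x z′ ≢ s → ⊥
  no-two-two-split {x = x} {y₁} {y₂} {z} {z′} {s} px py₁ py₂ pz pz′ y₁≢y₂ z≢z′ xy₁ xy₂ xz xz′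
    with transposed-row px py₁ pz
  ... | x₁ , px₁ , row₁ with transposed-row px₁ py₂ pz′
  ...   | x₃ , px₃ , row₃ =
    z≢z′ (gain-subsingleton px px₁ px₃ (x-lacks x₁z) (x-lacks x₃z) (transposed-gain row₁ xy₁)
            (pz , x₃z , xz) (pz′ , x₃z′ , xz′))
    where
      x-lacks : ∀ {x′} → c x′ z ≡ s → x ≢ x′
      x-lacks x′z refl = xz x′z
      z≢y₂ : z ≢ y₂
      z≢y₂ refl = xz xy₂
      x₁z : c x₁ z ≡ s
      x₁z = trans (row₁ z pz) (trans (cong (c x) (transpose-matchʳ y₁ z)) xy₁)
      x₁y₂ : c x₁ y₂ ≡ s
      x₁y₂ = trans (row₁ y₂ py₂)
        (trans (cong (c x) (transpose-other (λ e → y₁≢y₂ (sym e)) (λ e → z≢y₂ (sym e)))) xy₂)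
      x₃z : c x₃ z ≡ s
      x₃z = trans (row₃ z pz) (trans (cong (c x₁) (transpose-other z≢y₂ z≢z′)) x₁z)
      x₃z′ : c x₃ z′ ≡ s
      x₃z′ = trans (row₃ z′ pz′) (trans (cong (c x₁) (transpose-matchʳ y₂ z′)) x₁y₂)

module ColourGeometry {n m} (c : Colouring n m) (lift : TranspositionsLift c) where
  open RowGeometry c lift public
  private module Columns = RowGeometry (flip c) (flip-lift lift)

  -- The three rows obtained by transposing pairs among y₁, y₂, y₃ split the column
  -- of y₁ two against two.
  no-three-colours : ∀ {ρ σ x y₁ y₂ y₃} → InFiberOf c ρ x →
    InFiberOf c σ y₁ → InFiberOf c σ y₂ → InFiberOf c σ y₃ →
    c x y₁ ≢ c x y₂ → c x y₁ ≢ c x y₃ → c x y₂ ≢ c x y₃ → ⊥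
  no-three-colours {x = x} {y₁} {y₂} {y₃} px py₁ py₂ py₃ x₁₂ x₁₃ x₂₃
    with transposed-row px py₂ py₃ | transposed-row px py₁ py₂ | transposed-row px py₁ py₃
  ... | x′ , px′ , row′ | x″ , px″ , row″ | x‴ , px‴ , row‴ =
    Columns.no-two-two-split py₁ px px′ px″ px‴ x≢x′ x″≢x‴ refl x′y₁ x″y₁ x‴y₁
    where
      y₁≢y₂ : y₁ ≢ y₂
      y₁≢y₂ refl = x₁₂ refl
      y₁≢y₃ : y₁ ≢ y₃
      y₁≢y₃ refl = x₁₃ refl
      x′y₁ : c x′ y₁ ≡ c x y₁
      x′y₁ = trans (row′ y₁ py₁) (cong (c x) (transpose-other y₁≢y₂ y₁≢y₃))
      x″y₁ : c x″ y₁ ≢ c x y₁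
      x″y₁ e = x₁₂ (trans (sym e) (trans (row″ y₁ py₁) (cong (c x) (transpose-matchˡ y₁ y₂))))
      x‴y₁ : c x‴ y₁ ≢ c x y₁
      x‴y₁ e = x₁₃ (trans (sym e) (trans (row‴ y₁ py₁) (cong (c x) (transpose-matchˡ y₁ y₃))))
      x≢x′ : x ≢ x′
      x≢x′ refl = x₂₃ (trans (row′ y₂ py₂) (cong (c x) (transpose-matchˡ y₂ y₃)))
      x″≢x‴ : x″ ≢ x‴
      x″≢x‴ refl = x₂₃ (trans (trans (cong (c x) (sym (transpose-matchˡ y₁ y₂))) (sym (row″ y₁ py₁)))
                              (trans (row‴ y₁ py₁) (cong (c x) (transpose-matchˡ y₁ y₃))))

module Coherence {n} (X : CoherentConfiguration n) where
  open CoherentConfiguration X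

  fiber-≡ : ∀ {ρ} {x y : Fiber X ρ} → proj₁ x ≡ proj₁ y → x ≡ y
  fiber-≡ {x = x , p} {.x , q} refl = cong (x ,_) (Decidable⇒UIP.≡-irrelevant _≟_ p q)

  -- Coherence says |αr ∩ βs*| = |α′r ∩ β′s*|, so one side is nonempty iff the other is.
  path-transfer : ∀ {α β α′ β′ γ r s} → c α β ≡ c α′ β′ → c α γ ≡ r → c γ β ≡ s →
    ∃ λ γ′ → c α′ γ′ ≡ r × c γ′ β′ ≡ s
  path-transfer {α} {β} {α′} {β′} {γ} {r} {s} eq αγ γβ
    with nonempty-of-length-≡ _ _ (coherence r s α β α′ β′ eq)
           (∈-filter⁺ (λ γ → (c α γ ≟ r) ×-dec (c γ β ≟ s)) (∈-allFin γ) (αγ , γβ))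
  ... | γ′ , γ′∈ =
    γ′ , proj₂ (∈-filter⁻ (λ γ → (c α′ γ ≟ r) ×-dec (c γ β′ ≟ s)) {xs = allFin n} γ′∈)

  colour-determines-fibers : ∀ {α β α′ β′} → c α β ≡ c α′ β′ →
    c α α ≡ c α′ α′ × c β β ≡ c β′ β′
  colour-determines-fibers {α} {β} {α′} {β′} eq
    with path-transfer {γ = α} eq refl refl | path-transfer {γ = β} eq refl refl
  ... | γ , α′γ , _ | γ₂ , _ , γ₂β′ =
    sym (trans (cong (c α′) (diagonal α α′ γ α′γ)) α′γ) ,
    sym (trans (cong (λ z → c z β′) (sym (diagonal β γ₂ β′ γ₂β′))) γ₂β′)

  converse-cong : ∀ {α β α′ β′} → c α β ≡ c α′ β′ → c β α ≡ c β′ α′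
  converse-cong {α} {β} {α′} {β′} eq with converse (c α β)
  ... | _ , conv = trans (⇔.to (conv α β) refl) (sym (⇔.to (conv α′ β′) (sym eq)))

  colour-in-S : ∀ {δ₀ λ₀ x y} → InFiber X δ₀ x → InFiber X λ₀ y → InS X δ₀ λ₀ (c x y)
  colour-in-S Dx Ly α β eq =
    trans (proj₁ (colour-determines-fibers eq)) Dx , trans (proj₂ (colour-determines-fibers eq)) Ly

  graph-functional : ∀ {δ₀ λ₀ s u y₁ y₂} → InS X δ₀ λ₀ s → IsBijectionGraph X δ₀ λ₀ s →
    InFiber X δ₀ u → c u y₁ ≡ s → c u y₂ ≡ s → y₁ ≡ y₂
  graph-functional {u = u} {y₁} {y₂} s∈S (_ , graph) Du uy₁ uy₂ = cong proj₁ (trans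
    (sym (⇔.to (graph (u , Du) (y₁ , proj₂ (s∈S u y₁ uy₁))) uy₁))
    (⇔.to (graph (u , Du) (y₂ , proj₂ (s∈S u y₂ uy₂))) uy₂))

  graph-total : ∀ {δ₀ λ₀ s u} → IsBijectionGraph X δ₀ λ₀ s → InFiber X δ₀ u →
    ∃ λ y → c u y ≡ s
  graph-total (φ , graph) Du = proj₁ (to φ (_ , Du)) , ⇔.from (graph _ _) refl

  graph-onto : ∀ {δ₀ λ₀ s y} → IsBijectionGraph X δ₀ λ₀ s → InFiber X λ₀ y →
    ∃ λ u → InFiber X δ₀ u × c u y ≡ s
  graph-onto (φ , graph) Ly =
    proj₁ (from φ (_ , Ly)) , proj₂ (from φ (_ , Ly)) , ⇔.from (graph _ _) (strictlyInverseˡ φ _)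

  singleton-constant : ∀ {δ₀ λ₀ u v y z} → IsSingleton X δ₀ λ₀ →
    InFiber X δ₀ u → InFiber X δ₀ v → InFiber X λ₀ y → InFiber X λ₀ z → c u y ≡ c v z
  singleton-constant (_ , _ , only) Du Dv Ly Lz =
    trans (only _ (colour-in-S Du Ly)) (sym (only _ (colour-in-S Dv Lz)))

  at-most-two : ∀ {δ₀ λ₀} → IsSingleton X δ₀ λ₀ ⊎ TwoWithBijection X δ₀ λ₀ →
    ∃₂ λ s s′ → ∀ t → InS X δ₀ λ₀ t → t ≡ s ⊎ t ≡ s′
  at-most-two (inj₁ (s , _ , only))                  = s , s , λ t t∈S → inj₁ (only t t∈S)
  at-most-two (inj₂ (s , s′ , _ , _ , _ , only , _)) = s , s′ , only

fiber-transposition : ∀ {n} (X : CoherentConfiguration n) {ρ a b} →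
  InFiber X ρ a → InFiber X ρ b → Fiber X ρ ↔ Fiber X ρ
fiber-transposition X {a = a} {b} pa pb = mk↔ₛ′ (swap pa pb) (swap pb pa)
  (λ y → fiber-≡ (transpose-inverse a b)) (λ y → fiber-≡ (transpose-inverse b a))
  where
    open Coherence X
    swap : ∀ {ρ i j} → InFiber X ρ i → InFiber X ρ j → Fiber X ρ → Fiber X ρ
    swap {ρ} {i} {j} pi pj (w , pw) = transpose i j w , transpose-closed {P = InFiber X ρ} pi pj pw

quasitrivial⇒transpositions-lift : ∀ {n} (X : CoherentConfiguration n) →
  Quasitrivial X → TranspositionsLift (CoherentConfiguration.c X)
quasitrivial⇒transpositions-lift X qt ρ a b pa pb
  with qt ρ (fiber-transposition X pa pb)
... | f , f-aut , f-agrees = record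
  { aut = f ; preserves = f-aut ; agrees = λ w pw → f-agrees (w , pw) }

module FromTranspositions {n} (X : CoherentConfiguration n)
                (lift : TranspositionsLift (CoherentConfiguration.c X)) where
  open CoherentConfiguration X
  open Coherence X
  open ColourGeometry c lift

  module _ (δ₀ λ₀ : Fin n) where
    D L : Fin n → Set
    D = InFiber X δ₀
    L = InFiber X λ₀

    singleton-of-constant : (∀ {x y} → D x → L y → c x y ≡ c δ₀ λ₀) → IsSingleton X δ₀ λ₀
    singleton-of-constant constant = c δ₀ λ₀ , colour-in-S refl refl , only
      where
        only : ∀ t → InS X δ₀ λ₀ t → t ≡ c δ₀ λ₀
        only t t∈S with nonempty t
        ... | (α , β) , αβ = trans (sym αβ) (constant (proj₁ (t∈S α β αβ)) (proj₂ (t∈S α β αβ)))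

    record SplitRow : Set where
      field
        ys yt        : Fin n
        L-ys         : L ys
        L-yt         : L yt
        s≢t          : c δ₀ ys ≢ c δ₀ yt
        s-unique     : ∀ {y} → L y → c δ₀ y ≡ c δ₀ ys → y ≡ ys
        two-coloured : ∀ {y} → L y → c δ₀ y ≡ c δ₀ ys ⊎ c δ₀ y ≡ c δ₀ yt

      s t : Fin m
      s = c δ₀ ys
      t = c δ₀ yt

    two-colours-in-row : ∀ {ya yb} → L ya → L yb → c δ₀ ya ≢ c δ₀ yb →
      ∀ {y} → L y → c δ₀ y ≡ c δ₀ ya ⊎ c δ₀ y ≡ c δ₀ yb
    two-colours-in-row {ya} {yb} L-ya L-yb a≢b {y} Ly with c δ₀ y ≟ c δ₀ ya | c δ₀ y ≟ c δ₀ yb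
    ... | yes eq | _      = inj₁ eq
    ... | no _   | yes eq = inj₂ eq
    ... | no ≢a  | no ≢b  =
      ⊥-elim (no-three-colours refl L-ya L-yb Ly a≢b (λ e → ≢a (sym e)) (λ e → ≢b (sym e)))

    split-row : ∀ {ya yb} → L ya → L yb → c δ₀ ya ≢ c δ₀ yb → SplitRow
    split-row {ya} {yb} L-ya L-yb a≢b
      with any? (λ y → (c y y ≟ c λ₀ λ₀) ×-dec ¬? (y ≟ ya) ×-dec (c δ₀ y ≟ c δ₀ ya))
    ... | yes (y₂ , L-y₂ , y₂≢ya , δ₀y₂) = record
      { ys = yb ; yt = ya ; L-ys = L-yb ; L-yt = L-ya ; s≢t = λ e → a≢b (sym e)
      ; s-unique = b-unique ; two-coloured = λ Ly → Sum.swap (two-colours-in-row L-ya L-yb a≢b Ly) }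
      where
        b-unique : ∀ {y} → L y → c δ₀ y ≡ c δ₀ yb → y ≡ yb
        b-unique {y} Ly δ₀y with y ≟ yb
        ... | yes eq = eq
        ... | no y≢yb = ⊥-elim (no-two-two-split refl Ly L-yb L-ya L-y₂ y≢yb
                          (λ e → y₂≢ya (sym e)) δ₀y refl a≢b (λ e → a≢b (trans (sym δ₀y₂) e)))
    ... | no a-unique = record
      { ys = ya ; yt = yb ; L-ys = L-ya ; L-yt = L-yb ; s≢t = a≢b
      ; s-unique = s-unique ; two-coloured = two-colours-in-row L-ya L-yb a≢b }
      where
        s-unique : ∀ {y} → L y → c δ₀ y ≡ c δ₀ ya → y ≡ ya
        s-unique {y} Ly δ₀y with y ≟ ya
        ... | yes eq = eq
        ... | no y≢ya = ⊥-elim (a-unique (y , Ly , y≢ya , δ₀y))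

    module Split (split : SplitRow) where
      open SplitRow split

      module Row {x} (Dx : D x) where
        private
          e : AutExtending c δ₀ (transpose δ₀ x)
          e = lift δ₀ δ₀ x refl Dx
        open AutExtending e

        moves : to aut δ₀ ≡ x
        moves = transposition-swaps e refl

        image : ∃ λ y → L y × c x y ≡ s
        image = to aut ys , maps-fiber L-ys , transports ys moves

        image-unique : ∀ {w w′} → L w → L w′ → c x w ≡ s → c x w′ ≡ s → w ≡ w′
        image-unique Lw Lw′ xw xw′ = from-injective aut
          (trans (s-unique (inverse-maps-fiber Lw) (trans (sym (transports⁻ _ moves)) xw))
            (sym (s-unique (inverse-maps-fiber Lw′) (trans (sym (transports⁻ _ moves)) xw′))))

        colours : ∀ {w} → L w → c x w ≡ s ⊎ c x w ≡ t
        colours {w} Lw rewrite transports⁻ w moves = two-coloured (inverse-maps-fiber Lw)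

      preimage : ∀ {y} → L y → ∃ λ x → D x × c x y ≡ s
      preimage {y} Ly = to aut δ₀ , maps-fiber refl ,
        trans (cong (c _) (sym moves)) (transports ys refl)
        where
          e : AutExtending c λ₀ (transpose ys y)
          e = lift λ₀ ys y L-ys Ly
          open AutExtending e
          moves : to aut ys ≡ y
          moves = transposition-swaps e L-ys

      another-point : ∀ {y} → L y → ∃ λ y′ → L y′ × y′ ≢ y
      another-point {y} Ly with y ≟ ys
      ... | yes refl = yt , L-yt , λ { refl → s≢t refl }
      ... | no y≢ys  = ys , L-ys , λ e → y≢ys (sym e)

      -- Otherwise the automorphism swapping x₁ with a row x₃ missing y, and fixing x₂,
      -- would move y both to itself and off it.
      preimage-unique : ∀ {x₁ x₂ y} → D x₁ → D x₂ → L y → c x₁ y ≡ s → c x₂ y ≡ s → x₁ ≡ x₂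
      preimage-unique {x₁} {x₂} {y} Dx₁ Dx₂ Ly x₁y x₂y with x₁ ≟ x₂
      ... | yes eq = eq
      ... | no x₁≢x₂ with another-point Ly
      ...   | y′ , Ly′ , y′≢y with preimage Ly′
      ...     | x₃ , Dx₃ , x₃y′ = ⊥-elim (y′≢y (trans (sym to-y′) to-y))
        where
          e : AutExtending c δ₀ (transpose x₁ x₃)
          e = lift δ₀ x₁ x₃ Dx₁ Dx₃
          open AutExtending e
          x₃-misses : c x₃ y ≢ s
          x₃-misses x₃y = y′≢y (Row.image-unique Dx₃ Ly′ Ly x₃y′ x₃y)
          fixes-x₂ : to aut x₂ ≡ x₂
          fixes-x₂ = transposition-fixes e Dx₂ (λ x₂≡x₁ → x₁≢x₂ (sym x₂≡x₁))
                                                 (λ { refl → x₃-misses x₂y })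
          moves-x₁ : to aut x₁ ≡ x₃
          moves-x₁ = transposition-swaps e Dx₁
          to-y : to aut y ≡ y
          to-y = Row.image-unique Dx₂ (maps-fiber Ly) Ly (trans (transports y fixes-x₂) x₂y) x₂y
          to-y′ : to aut y ≡ y′
          to-y′ = Row.image-unique Dx₃ (maps-fiber Ly) Ly′ (trans (transports y moves-x₁) x₁y) x₃y′

      φ : Fiber X δ₀ → Fiber X λ₀
      φ (x , Dx) = proj₁ (Row.image Dx) , proj₁ (proj₂ (Row.image Dx))

      φ-colour : ∀ (x : Fiber X δ₀) → c (proj₁ x) (proj₁ (φ x)) ≡ s
      φ-colour (x , Dx) = proj₂ (proj₂ (Row.image Dx))

      ψ : Fiber X λ₀ → Fiber X δ₀
      ψ (y , Ly) = proj₁ (preimage Ly) , proj₁ (proj₂ (preimage Ly))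

      ψ-colour : ∀ (y : Fiber X λ₀) → c (proj₁ (ψ y)) (proj₁ y) ≡ s
      ψ-colour (y , Ly) = proj₂ (proj₂ (preimage Ly))

      bijection : Fiber X δ₀ ↔ Fiber X λ₀
      bijection = mk↔ₛ′ φ ψ
        (λ y → fiber-≡ (Row.image-unique (proj₂ (ψ y)) (proj₂ (φ (ψ y))) (proj₂ y)
                          (φ-colour (ψ y)) (ψ-colour y)))
        (λ x → fiber-≡ (preimage-unique (proj₂ (ψ (φ x))) (proj₂ x) (proj₂ (φ x))
                          (ψ-colour (φ x)) (φ-colour x)))

      two-with-bijection : TwoWithBijection X δ₀ λ₀
      two-with-bijection =
        s , t , s≢t , colour-in-S refl L-ys , colour-in-S refl L-yt , within-s-t , bijection , graph
        where
          within-s-t : ∀ r → InS X δ₀ λ₀ r → r ≡ s ⊎ r ≡ t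
          within-s-t r r∈S with nonempty r
          ... | (α , β) , αβ = Sum.map (trans (sym αβ)) (trans (sym αβ))
                                 (Row.colours (proj₁ (r∈S α β αβ)) (proj₂ (r∈S α β αβ)))
          graph : ∀ x y → (c (proj₁ x) (proj₁ y) ≡ s) ⇔ (φ x ≡ y)
          graph x y = mk⇔
            (λ xy → fiber-≡ (Row.image-unique (proj₂ x) (proj₂ (φ x)) (proj₂ y) (φ-colour x) xy))
            (λ { refl → φ-colour x })

    fiber-condition : IsSingleton X δ₀ λ₀ ⊎ TwoWithBijection X δ₀ λ₀
    fiber-condition
      with any? (λ x → any? (λ y →
             (c x x ≟ c δ₀ δ₀) ×-dec (c y y ≟ c λ₀ λ₀) ×-dec ¬? (c x y ≟ c δ₀ λ₀)))
    -- Transporting the row of x₁ to δ₀ shows that the row of δ₀ is not constant either.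
    ... | yes (x₁ , y₁ , Dx₁ , Ly₁ , x₁y₁) =
      inj₂ (Split.two-with-bijection (split-row refl (inverse-maps-fiber Ly₁)
        λ eq → x₁y₁ (trans (transports⁻ y₁ moves) (sym eq))))
      where
        e : AutExtending c δ₀ (transpose δ₀ x₁)
        e = lift δ₀ δ₀ x₁ refl Dx₁
        open AutExtending e
        moves : to aut δ₀ ≡ x₁
        moves = transposition-swaps e refl
    ... | no none = inj₁ (singleton-of-constant λ {x} {y} Dx Ly →
      decidable-stable (c x y ≟ c δ₀ λ₀) λ xy → none (x , y , Dx , Ly , xy))

module Extension {n} (X : CoherentConfiguration n) (fc : FiberCondition X) (α₀ : Fin n) where
  open CoherentConfiguration X
  open Coherence X

  fiber-permutation-preserves : (g : Fiber X α₀ ↔ Fiber X α₀) → ∀ u v →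
    c (proj₁ (to g u)) (proj₁ (to g v)) ≡ c (proj₁ u) (proj₁ v)
  fiber-permutation-preserves g (u , Du) (v , Dv) with u ≟ v
  ... | yes refl = trans (cong (λ w → c (proj₁ (to g (u , Du))) (proj₁ (to g w))) (fiber-≡ refl))
                     (trans (proj₂ (to g (u , Du))) (sym Du))
  ... | no u≢v with at-most-two (fc α₀ α₀)
  ...   | _ , _ , only =
    ≡-of-≢-in-pair (only _ (colour-in-S refl refl))
      (only _ (colour-in-S (proj₂ (to g (u , Du))) (proj₂ (to g (v , Dv)))))
      (only _ (colour-in-S Du Dv))
      (λ e → u≢v (cong proj₁ (from-injective (↔-sym g) (fiber-≡ (diagonal α₀ _ _ e)))))
      (λ e → u≢v (diagonal α₀ u v e))

  module Along (g : Fiber X α₀ ↔ Fiber X α₀) where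
    g̃ : Fiber X α₀ → Fin n
    g̃ u = proj₁ (to g u)

    -- The admissible images of β under an automorphism extending g.
    _↦_ : Fin n → Fin n → Set
    β ↦ y = ∀ (u : Fiber X α₀) → c (g̃ u) y ≡ c (proj₁ u) β

    singleton-↦ : ∀ {λ₀ β y} → IsSingleton X α₀ λ₀ → InFiber X λ₀ β → InFiber X λ₀ y → β ↦ y
    singleton-↦ single Lβ Ly u = singleton-constant single (proj₂ (to g u)) (proj₂ u) Ly Lβ

    -- If u₀ ∈ Δ is the s-partner of β, the image of β is the s-partner of g u₀.
    image : ∀ β → IsSingleton X α₀ β ⊎ TwoWithBijection X α₀ β → ∃ (β ↦_)
    image β (inj₁ single) = β , singleton-↦ single refl refl
    image β (inj₂ (s , _ , _ , s∈S , _ , _ , graph)) with graph-onto graph refl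
    ... | u₀ , Du₀ , u₀β with graph-total graph (proj₂ (to g (u₀ , Du₀)))
    ...   | y , gu₀y = y , λ u → partner u
      where
        partner : ∀ u → c (g̃ u) y ≡ c (proj₁ u) β
        partner u
          with path-transfer {γ = β} (sym (fiber-permutation-preserves g u (u₀ , Du₀))) refl refl
        ... | γ′ , guγ′ , γ′gu₀ = subst (λ w → c (g̃ u) w ≡ c (proj₁ u) β)
          (graph-functional s∈S graph (proj₂ (to g (u₀ , Du₀))) (trans (converse-cong γ′gu₀) u₀β) gu₀y)
          guγ′

    F : Fin n → Fin n
    F β = proj₁ (image β (fc α₀ β))

    F-↦ : ∀ β → β ↦ F β
    F-↦ β = proj₂ (image β (fc α₀ β))

    F-fiber : ∀ β → c (F β) (F β) ≡ c β β
    F-fiber β = sym (proj₂ (colour-determines-fibers (sym (F-↦ β (α₀ , refl)))))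

    ↦-unique : ∀ {β y₁ y₂} → TwoWithBijection X α₀ β → β ↦ y₁ → β ↦ y₂ → y₁ ≡ y₂
    ↦-unique (s , _ , _ , s∈S , _ , _ , graph) β↦y₁ β↦y₂ with graph-onto graph refl
    ... | u₀ , Du₀ , u₀β = graph-functional s∈S graph (proj₂ (to g (u₀ , Du₀)))
      (trans (β↦y₁ (u₀ , Du₀)) u₀β) (trans (β↦y₂ (u₀ , Du₀)) u₀β)

    F-unique : ∀ {β y} → TwoWithBijection X α₀ β → β ↦ y → F β ≡ y
    F-unique {β} two = ↦-unique two (F-↦ β)

    F-fixed : ∀ {β} → β ↦ β → F β ≡ β
    F-fixed {β} β↦β = fixed (fc α₀ β)
      where
        fixed : ∀ l → proj₁ (image β l) ≡ β
        fixed (inj₁ _)   = refl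
        fixed (inj₂ two) = ↦-unique two (proj₂ (image β (inj₂ two))) β↦β

    F-extends : ∀ x → F (proj₁ x) ≡ g̃ x
    F-extends x = by-cases (fc α₀ (proj₁ x))
      where
        by-cases : IsSingleton X α₀ (proj₁ x) ⊎ TwoWithBijection X α₀ (proj₁ x) → F (proj₁ x) ≡ g̃ x
        by-cases (inj₂ two)    = F-unique two (λ u → fiber-permutation-preserves g u x)
        by-cases (inj₁ single) = trans (F-fixed (singleton-↦ single refl refl))
          (diagonal (proj₁ x) (proj₁ x) (g̃ x) (singleton-constant single (proj₂ x) (proj₂ x)
            (trans (proj₂ (to g x)) (sym (proj₂ x))) refl))

    preserves-from-two : ∀ {α} → TwoWithBijection X α₀ α → ∀ β → c (F α) (F β) ≡ c α β
    preserves-from-two {α} (s , _ , _ , s∈S , _ , _ , graph) β with graph-onto graph refl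
    ... | u₀ , Du₀ , u₀α with path-transfer {γ = α} (sym (F-↦ β (u₀ , Du₀))) u₀α refl
    ...   | γ′ , gu₀γ′ , γ′Fβ = subst (λ w → c w (F β) ≡ c α β)
      (graph-functional s∈S graph (proj₂ (to g (u₀ , Du₀))) gu₀γ′ (trans (F-↦ α (u₀ , Du₀)) u₀α))
      γ′Fβ

    F-preserves : ∀ α β → c (F α) (F β) ≡ c α β
    F-preserves α β = by-cases (fc α₀ α) (fc α₀ β)
      where
        by-cases : IsSingleton X α₀ α ⊎ TwoWithBijection X α₀ α →
          IsSingleton X α₀ β ⊎ TwoWithBijection X α₀ β → c (F α) (F β) ≡ c α β
        by-cases (inj₂ two) _          = preserves-from-two two β
        by-cases (inj₁ _)   (inj₂ two) = converse-cong (preserves-from-two two α)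
        by-cases (inj₁ s₁)  (inj₁ s₂)  =
          cong₂ c (F-fixed (singleton-↦ s₁ refl refl)) (F-fixed (singleton-↦ s₂ refl refl))

  module Inverting (g h : Fiber X α₀ ↔ Fiber X α₀) (gh : ∀ u → to g (to h u) ≡ u) where
    private
      module G = Along g
      module H = Along h

    F-inverse : ∀ β → H.F (G.F β) ≡ β
    F-inverse β = by-cases (fc α₀ (G.F β))
      where
        back : H._↦_ (G.F β) β
        back u = sym (trans (cong (λ w → c (proj₁ w) (G.F β)) (sym (gh u))) (G.F-↦ β (to h u)))
        β∈Λ : InFiber X (G.F β) β
        β∈Λ = sym (G.F-fiber β)
        by-cases : IsSingleton X α₀ (G.F β) ⊎ TwoWithBijection X α₀ (G.F β) → H.F (G.F β) ≡ β
        by-cases (inj₂ two)    = H.F-unique two back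
        by-cases (inj₁ single) = trans (H.F-fixed (H.singleton-↦ single refl refl))
                                   (G.F-fixed (G.singleton-↦ single β∈Λ β∈Λ))

  extends-to-automorphism : InducesSym X α₀
  extends-to-automorphism g =
    mk↔ₛ′ (Along.F g) (Along.F g⁻¹) (Inverting.F-inverse g⁻¹ g (strictlyInverseʳ g))
      (Inverting.F-inverse g g⁻¹ (strictlyInverseˡ g)) ,
    Along.F-preserves g , Along.F-extends g
    where
      g⁻¹ : Fiber X α₀ ↔ Fiber X α₀
      g⁻¹ = ↔-sym g

lemma3p1 : ∀ {n : ℕ} (X : CoherentConfiguration n) →
    Quasitrivial X ⇔ FiberCondition X
lemma3p1 X = mk⇔
  (λ qt → FromTranspositions.fiber-condition X (quasitrivial⇒transpositions-lift X qt))
  (λ fc → Extension.extends-to-automorphism X fc)
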